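{- There exist stable matching instances $A$ and $B$ on the same workers and firms that are $(1,1)$, i.e. differ only in the preference lists of one worker and one firm, such that $\mathcal{M}_A\setminus\mathcal{M}_B$ is not a semi-sublattice of $\mathcal{L}_A$ (it is neither closed under $\vee_A$ nor under $\wedge_A$).
   Context: In a stable matching instance each agent strictly totally orders the agents of the other side; a perfect matching $M$ is stable under $I$ if no pair $(w,f)\notin M$ has $w$ preferring $f$ to $M(w)$ and $f$ preferring $w$ to $M(f)$ under $I$; $\mathcal{M}_I$ is the set of stable matchings of $I$ and $\mathcal{L}_I$ its lattice, with $M\vee_I M'$ giving each worker its less preferred (under $I$) partner among $M(w),M'(w)$, and $M\wedge_I M'$ the more preferred one. A join (meet) semi-sublattice is a subset closed under $\vee_I$ ($\wedge_I$). -}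

module Defs where

open import Data.Nat using (ℕ)
open import Data.Fin using (Fin; _<_; _≤?_)
open import Data.Bool using (if_then_else_)
open import Data.Product using (_×_; Σ; ∃-syntax)
open import Relation.Nullary using (¬_; does)
open import Relation.Binary.PropositionalEquality using (_≡_; _≢_)
open import Function.Definitions using (Injective)

-- A strict total order on the n agents of the other side is given by an
-- injective rank function (rank 0 = most preferred); on Fin n an injective
-- map Fin n → Fin n is a bijection, i.e. a complete preference list.
record Instance (n : ℕ) : Set where
  field
    wrank     : Fin n → Fin n → Fin n   -- wrank w f = rank of firm f in w's list
    wrank-inj : ∀ w → Injective _≡_ _≡_ (wrank w)
    frank     : Fin n → Fin n → Fin n   -- frank f w = rank of worker w in f's list
    frank-inj : ∀ f → Injective _≡_ _≡_ (frank f)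

open Instance public

module _ {n : ℕ} (I : Instance n) where

  WPrefers : Fin n → Fin n → Fin n → Set
  WPrefers w f f' = wrank I w f < wrank I w f'

  FPrefers : Fin n → Fin n → Fin n → Set
  FPrefers f w w' = frank I f w < frank I f w'

  -- A (candidate) matching is a function worker ↦ partner firm.
  -- (w , f) is a blocking pair of μ under I: (w,f) ∉ μ, w prefers f to μ(w),
  -- and f prefers w to its partner μ(f) (the worker w' with μ w' ≡ f).
  Blocking : (Fin n → Fin n) → Fin n → Fin n → Set
  Blocking μ w f =
    (μ w ≢ f) × WPrefers w f (μ w) × (∀ w' → μ w' ≡ f → FPrefers f w w')

  Stable : (Fin n → Fin n) → Set
  Stable μ = Injective _≡_ _≡_ μ × (∀ w f → ¬ Blocking μ w f)

  join : (Fin n → Fin n) → (Fin n → Fin n) → (Fin n → Fin n)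
  join μ μ' w = if does (wrank I w (μ' w) ≤? wrank I w (μ w)) then μ w else μ' w

  meet : (Fin n → Fin n) → (Fin n → Fin n) → (Fin n → Fin n)
  meet μ μ' w = if does (wrank I w (μ w) ≤? wrank I w (μ' w)) then μ w else μ' w

InDiff : {n : ℕ} → Instance n → Instance n → (Fin n → Fin n) → Set
InDiff A B μ = Stable A μ × ¬ Stable B μ

ClosedUnder : {n : ℕ} → ((Fin n → Fin n) → Set) →
              ((Fin n → Fin n) → (Fin n → Fin n) → (Fin n → Fin n)) → Set
ClosedUnder S op = ∀ μ μ' → S μ → S μ' → S (op μ μ')

OneOne : {n : ℕ} → Instance n → Instance n → Set
OneOne {n} A B = ∃[ w₀ ] ∃[ f₀ ]
  ((∀ w → w ≢ w₀ → ∀ f → wrank A w f ≡ wrank B w f) ×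
   (∀ f → f ≢ f₀ → ∀ w → frank A f w ≡ frank B f w))

-- In A the matchings (as worker–firm pairs)
-- μ₁ = {(0,0),(1,3),(2,1),(3,2)} and μ₂ = {(0,3),(1,0),(2,2),(3,1)} are stable;
-- B changes only the lists of worker 3 and firm 1, and then (1,1) blocks μ₁
-- and (3,3) blocks μ₂.  The A-join {(0,0),(1,3),(2,2),(3,1)} and the A-meet
-- {(0,3),(1,0),(2,1),(3,2)} of μ₁ and μ₂ are however still stable in B, so
-- they leave 𝓜_A ∖ 𝓜_B.  Every property involved is decidable over a finite
-- set, so the example is checked by evaluating decision procedures.
module Submission where

open import Defs
open import Data.Nat using (ℕ)
open import Data.Fin using (Fin; #_)
open import Data.Fin.Properties using (_≟_; _<?_; all?; any?)
open import Data.Product using (_×_; ∃-syntax; _,_)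
open import Data.Vec using (Vec; []; _∷_; lookup)
open import Function.Definitions using (Injective)
open import Relation.Nullary using (¬_; Dec)
open import Relation.Nullary.Decidable
  using (True; False; toWitness; toWitnessFalse; map′; ¬?; _×-dec_; _→-dec_)
open import Relation.Binary.PropositionalEquality using (_≡_)

injective? : ∀ {m n} (g : Fin m → Fin n) → Dec (Injective _≡_ _≡_ g)
injective? g =
  map′ (λ inj {x} {y} → inj x y) (λ inj x y → inj {x} {y})
       (all? λ x → all? λ y → (g x ≟ g y) →-dec (x ≟ y))

rowsInjective? : ∀ {k m n} (r : Fin k → Fin m → Fin n) →
                 Dec (∀ a → Injective _≡_ _≡_ (r a))
rowsInjective? r = all? λ a → injective? (r a)

module _ {n : ℕ} (I : Instance n) where

  blocking? : (μ : Fin n → Fin n) → ∀ w f → Dec (Blocking I μ w f)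
  blocking? μ w f =
    ¬? (μ w ≟ f) ×-dec (wrank I w f <? wrank I w (μ w))
      ×-dec (all? λ w' → (μ w' ≟ f) →-dec (frank I f w <? frank I f w'))

  stable? : (μ : Fin n → Fin n) → Dec (Stable I μ)
  stable? μ = injective? μ ×-dec (all? λ w → all? λ f → ¬? (blocking? μ w f))

module _ {n : ℕ} (A B : Instance n) where

  inDiff? : (μ : Fin n → Fin n) → Dec (InDiff A B μ)
  inDiff? μ = stable? A μ ×-dec ¬? (stable? B μ)

  oneOne? : Dec (OneOne A B)
  oneOne? =
    any? λ w₀ → any? λ f₀ →
      (all? λ w → ¬? (w ≟ w₀) →-dec (all? λ f → wrank A w f ≟ wrank B w f))
      ×-dec (all? λ f → ¬? (f ≟ f₀) →-dec (all? λ w → frank A f w ≟ frank B f w))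

witnesses⇒¬ClosedUnder : ∀ {n} {S : (Fin n → Fin n) → Set} {op} μ μ' →
                         S μ → S μ' → ¬ S (op μ μ') → ¬ ClosedUnder S op
witnesses⇒¬ClosedUnder μ μ' Sμ Sμ' ¬Sop closed = ¬Sop (closed μ μ' Sμ Sμ')

table : ∀ {n} → Vec (Vec (Fin n) n) n → Fin n → Fin n → Fin n
table t a b = lookup (lookup t a) b

fromRankTables : ∀ {n} (wr fr : Vec (Vec (Fin n) n) n) →
                 {True (rowsInjective? (table wr))} →
                 {True (rowsInjective? (table fr))} → Instance n
fromRankTables wr fr {wr-inj} {fr-inj} = record
  { wrank = table wr ; wrank-inj = toWitness wr-inj
  ; frank = table fr ; frank-inj = toWitness fr-inj }

-- Row a of a table lists the ranks a gives to agents 0, 1, 2, 3 of the other side.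
A : Instance 4
A = fromRankTables
  ( (# 1 ∷ # 3 ∷ # 2 ∷ # 0 ∷ [])
    ∷ (# 0 ∷ # 2 ∷ # 1 ∷ # 3 ∷ [])
    ∷ (# 1 ∷ # 0 ∷ # 3 ∷ # 2 ∷ [])
    ∷ (# 3 ∷ # 1 ∷ # 0 ∷ # 2 ∷ [])
    ∷ [])
  ( (# 0 ∷ # 1 ∷ # 2 ∷ # 3 ∷ [])
    ∷ (# 0 ∷ # 3 ∷ # 2 ∷ # 1 ∷ [])
    ∷ (# 2 ∷ # 3 ∷ # 0 ∷ # 1 ∷ [])
    ∷ (# 2 ∷ # 0 ∷ # 3 ∷ # 1 ∷ [])
    ∷ [])

B : Instance 4
B = fromRankTables
  ( (# 1 ∷ # 3 ∷ # 2 ∷ # 0 ∷ [])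
    ∷ (# 0 ∷ # 2 ∷ # 1 ∷ # 3 ∷ [])
    ∷ (# 1 ∷ # 0 ∷ # 3 ∷ # 2 ∷ [])
    ∷ (# 0 ∷ # 3 ∷ # 1 ∷ # 2 ∷ [])
    ∷ [])
  ( (# 0 ∷ # 1 ∷ # 2 ∷ # 3 ∷ [])
    ∷ (# 0 ∷ # 2 ∷ # 3 ∷ # 1 ∷ [])
    ∷ (# 2 ∷ # 3 ∷ # 0 ∷ # 1 ∷ [])
    ∷ (# 2 ∷ # 0 ∷ # 3 ∷ # 1 ∷ [])
    ∷ [])

μ₁ μ₂ : Fin 4 → Fin 4
μ₁ = lookup (# 0 ∷ # 3 ∷ # 1 ∷ # 2 ∷ [])
μ₂ = lookup (# 3 ∷ # 0 ∷ # 2 ∷ # 1 ∷ [])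

lemma6 : ∃[ n ] ∃[ A ] ∃[ B ]
           (OneOne {n} A B ×
            ¬ ClosedUnder (InDiff A B) (join A) ×
            ¬ ClosedUnder (InDiff A B) (meet A))
lemma6 = 4 , A , B , toWitness {a? = oneOne? A B} _
       , witnesses⇒¬ClosedUnder μ₁ μ₂ μ₁∈ μ₂∈ join∉
       , witnesses⇒¬ClosedUnder μ₁ μ₂ μ₁∈ μ₂∈ meet∉
  where
  μ₁∈ : InDiff A B μ₁
  μ₁∈ = toWitness {a? = inDiff? A B μ₁} _
  μ₂∈ : InDiff A B μ₂
  μ₂∈ = toWitness {a? = inDiff? A B μ₂} _
  join∉ : ¬ InDiff A B (join A μ₁ μ₂)
  join∉ = toWitnessFalse {a? = inDiff? A B (join A μ₁ μ₂)} _
  meet∉ : ¬ InDiff A B (meet A μ₁ μ₂)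
  meet∉ = toWitnessFalse {a? = inDiff? A B (meet A μ₁ μ₂)} _
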